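{- Let $N$ be a set of ground clauses, ordered by a superposition ordering $\prec$ as described in the context. If $N$ has a minimal false clause $C \neq \bot$, then exactly one rule is applicable to $N$ according to the SUP-MO strategy. That is: if the maximal literal $L$ of $C$ is negative, the prescribed step is Superposition Left between $C$ and a clause $D \in N$ with $D \prec C$ whose strictly maximal literal is $\operatorname{comp}(L)$ and with $\delta_D = \{\operatorname{comp}(L)\}$, and such a clause $D$ exists and the rule is applicable to $C$ and $D$; if the maximal literal $L$ of $C$ is positive, the prescribed step is Factoring on $C$, and $L$ is not strictly maximal in $C$, so that Factoring is applicable to $C$.
   Context: We work in first-order logic without equality, restricted to ground clauses. A clause is a finite multiset of literals, read as their disjunction; $\bot$ denotes the empty clause, and $\operatorname{comp}(L)$ denotes the complement of a literal $L$. Let $\prec$ be a well-founded, total, strict ordering on ground literals (as is standard for superposition, literals are compared by their atoms first, and for the same atom $A$ one has $A \prec \neg A$), lifted to clauses by its multiset extension. A literal $L$ is maximal in a clause $C$ if no literal of $C$ is greater than $L$, and strictly maximal if in addition $L$ occurs exactly once in $C$ and no other literal of $C$ equals or exceeds it. A (partial) Herbrand model is a set $I$ of ground atoms; a ground clause $C$ is true in $I$, written $I \models_H C$, if some positive literal $A$ of $C$ satisfies $A \in I$ or some negative literal $\neg A$ of $C$ satisfies $A \notin I$; otherwise it is false in $I$. Superposition model operator: for a set $N$ of ground clauses, define recursively over $C \in N$ (w.r.t. $\prec$): $N_C = \bigcup_{D \in N,\, D \prec C} \delta_D$, where $\delta_D = \{B\}$ if $D = D' \lor B$ with $B$ a positive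 literal that is strictly maximal in $D$ and $N_D \not\models_H D$, and $\delta_D = \emptyset$ otherwise. A clause $C$ produces $B$ if $\delta_C = \{B\}$. The minimal false clause of $N$ is the $\prec$-smallest $C \in N$ such that $N_C \cup \delta_C \not\models_H C$ (if one exists). Ground superposition rules (without selection), on a clause set $N$: Superposition Left: from $C_1 \lor A$ and $C_2 \lor \neg A$ in $N$, where $A$ is strictly maximal in $C_1 \lor A$ and $\neg A$ is maximal in $C_2 \lor \neg A$, add $C_1 \lor C_2$ to $N$. Factoring: from $C \lor A \lor A$ in $N$ with $A$ a positive literal maximal in $C \lor A \lor A$, add $C \lor A$ to $N$. SUP-MO strategy: given $N$, (1) if $N$ has no minimal false clause, stop; (2) if the minimal false clause is $\bot$, stop; (3) if the minimal false clause $C$ has a negative maximal literal $L$, apply Superposition Left to $C$ and a clause $D \in N$ with $D \prec C$, strictly maximal literal $\operatorname{comp}(L)$ and $\delta_D = \{\operatorname{comp}(L)\}$; (4) if the minimal false clause $C$ has a positive maximal literal $L$, apply Factoring to $C$. -}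

module Defs where

open import Data.Bool using (Bool; true; false)
open import Data.Empty using (⊥)
open import Data.List using (List; []; _∷_; _++_)
open import Data.List.Relation.Unary.Any using (Any)
open import Data.List.Relation.Unary.All using (All)
open import Data.List.Membership.Propositional using (_∈_)
open import Data.List.Relation.Binary.Permutation.Propositional using (_↭_)
open import Data.Product using (Σ; _×_; ∃; ∃-syntax)
open import Data.Sum using (_⊎_)
open import Relation.Nullary using (¬_)
open import Relation.Binary.PropositionalEquality using (_≡_; _≢_)
open import Function.Bundles using (_⇔_)

module Ground (Atom : Set) (_<_ : Atom → Atom → Set) where

  data Lit : Set where
    pos : Atom → Lit
    neg : Atom → Lit

  atom : Lit → Atom
  atom (pos A) = A
  atom (neg A) = A

  comp : Lit → Lit
  comp (pos A) = neg A
  comp (neg A) = pos A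

  data _≺L_ : Lit → Lit → Set where
    atom< : ∀ {L L'} → atom L < atom L' → L ≺L L'
    pos<neg : ∀ {A} → pos A ≺L neg A

  -- Clauses: finite multisets of literals, represented by lists
  -- (all notions below are invariant under permutation _↭_).
  Clause : Set
  Clause = List Lit

  -- Multiset extension of ≺L (Dershowitz–Manna / Huet–Oppen form):
  -- C₁ ≺ C₂ iff C₂ = Z + X, C₁ = Z + Y, X ≠ ∅ and every y ∈ Y is below some x ∈ X.
  _≺C_ : Clause → Clause → Set
  C₁ ≺C C₂ = Σ Clause λ Z → Σ Clause λ X → Σ Clause λ Y →
               (C₂ ↭ Z ++ X) × (C₁ ↭ Z ++ Y) × (X ≢ []) ×
               All (λ y → Any (λ x → y ≺L x) X) Y

  Maximal : Lit → Clause → Set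
  Maximal L C = (L ∈ C) × (∀ {L'} → L' ∈ C → ¬ (L ≺L L'))

  StrictlyMaximal : Lit → Clause → Set
  StrictlyMaximal L C = Σ Clause λ C' → (C ↭ L ∷ C') × All (λ L' → L' ≺L L) C'

  Interp : Set₁
  Interp = Atom → Set

  _⊨L_ : Interp → Lit → Set
  I ⊨L pos A = I A
  I ⊨L neg A = ¬ I A

  _⊨_ : Interp → Clause → Set
  I ⊨ C = Any (I ⊨L_) C

  _∪I_ : Interp → Interp → Interp
  (I ∪I J) A = I A ⊎ J A

  ClauseSet : Set₁
  ClauseSet = Clause → Set

  module Model (N : ClauseSet) (δ : Clause → Atom → Set) where
    -- δ D B  stands for  δ_D = {B}  ("D produces B").

    NC : Clause → Interp
    NC C A = Σ Clause λ D → N D × (D ≺C C) × δ D A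

    δI : Clause → Interp
    δI C = δ C

    -- δ is the superposition model operator for N: the defining recursive
    -- equation (unique solution since ≺C is well-founded).
    IsModelOperator : Set
    IsModelOperator = ∀ D B →
      δ D B ⇔ (N D × StrictlyMaximal (pos B) D × ¬ (NC D ⊨ D))

    MinimalFalse : Clause → Set
    MinimalFalse C =
      N C × ¬ ((NC C ∪I δI C) ⊨ C) ×
      (∀ C' → N C' → ¬ ((NC C' ∪I δI C') ⊨ C') → ¬ (C' ≺C C))

  SupLeftApplicable : ClauseSet → Clause → Clause → Atom → Set
  SupLeftApplicable N D C A =
    N D × N C ×
    (Σ Clause λ C₁ → Σ Clause λ C₂ → (D ↭ C₁ ++ pos A ∷ []) × (C ↭ C₂ ++ neg A ∷ [])) ×
    StrictlyMaximal (pos A) D × Maximal (neg A) C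

  FactoringApplicable : ClauseSet → Clause → Atom → Set
  FactoringApplicable N C A =
    N C × (Σ Clause λ C' → C ↭ C' ++ pos A ∷ pos A ∷ []) × Maximal (pos A) C

{-# OPTIONS --safe #-}
-- Let C be false in N_C ∪ δ_C with maximal literal L. If L = ¬A, then A is
-- true there; it is not produced by C itself, since a clause containing ¬A
-- cannot have A as strictly maximal literal, so it is produced by some D ≺ C,
-- and D, C are exactly the premises of Superposition Left. If L = A and A were
-- strictly maximal in C, then C would be false already in N_C (its negative
-- literals are not produced by C), so C would produce A and be true after all;
-- hence A is maximal but not strictly maximal, i.e. it occurs twice, and
-- Factoring applies.
module Submission where

open import Defs
open import Level using (0ℓ)
open import Axiom.ExcludedMiddle using (ExcludedMiddle)
open import Data.List using (List; []; _∷_; _++_)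
open import Data.List.Relation.Unary.Any using (here; there)
open import Data.List.Relation.Unary.All using (All; []; _∷_; lookup)
open import Data.List.Membership.Propositional using (_∈_; lose)
open import Data.List.Membership.Propositional.Properties using (∈-∃++)
open import Data.List.Relation.Binary.Permutation.Propositional
  using (_↭_; ↭-sym; ↭-trans; prep)
open import Data.List.Relation.Binary.Permutation.Propositional.Properties
  using (∈-resp-↭; shift; ++-comm; ∷↭∷ʳ)
open import Data.Product using (Σ; _×_; _,_; proj₁; proj₂)
open import Data.Sum using (_⊎_; inj₁; inj₂)
open import Data.Empty using (⊥-elim)
open import Relation.Nullary using (¬_; yes; no)
open import Relation.Binary.PropositionalEquality using (_≡_; _≢_; refl)
open import Relation.Binary.Structures using (IsStrictTotalOrder)
open import Relation.Binary.Definitions using (tri<; tri≈; tri>)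
open import Induction.WellFounded using (WellFounded)
open import Function.Bundles using (Equivalence)

∈⇒↭∷ : ∀ {A : Set} {x : A} {xs} → x ∈ xs → Σ (List A) λ ys → xs ↭ x ∷ ys
∈⇒↭∷ {x = x} x∈xs with ys , zs , refl ← ∈-∃++ x∈xs = ys ++ zs , shift x ys zs

module GroundFacts (Atom : Set) (_<_ : Atom → Atom → Set)
                   (<-sto : IsStrictTotalOrder _≡_ _<_) where
  open Ground Atom _<_
  open IsStrictTotalOrder <-sto using (compare; irrefl)

  compare-pos : ∀ A L → L ≺L pos A ⊎ L ≡ pos A ⊎ pos A ≺L L
  compare-pos A (pos B) with compare B A
  ... | tri< B<A _ _ = inj₁ (atom< B<A)
  ... | tri≈ _ refl _ = inj₂ (inj₁ refl)
  ... | tri> _ _ A<B = inj₂ (inj₂ (atom< A<B))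
  compare-pos A (neg B) with compare B A
  ... | tri< B<A _ _ = inj₁ (atom< B<A)
  ... | tri≈ _ refl _ = inj₂ (inj₂ pos<neg)
  ... | tri> _ _ A<B = inj₂ (inj₂ (atom< A<B))

  notAbove⇒allBelow⊎∈ : ∀ A C → (∀ {L} → L ∈ C → ¬ pos A ≺L L) →
                        All (_≺L pos A) C ⊎ pos A ∈ C
  notAbove⇒allBelow⊎∈ A [] _ = inj₁ []
  notAbove⇒allBelow⊎∈ A (L ∷ C) notAbove with compare-pos A L
  ... | inj₂ (inj₂ A≺L) = ⊥-elim (notAbove (here refl) A≺L)
  ... | inj₂ (inj₁ refl) = inj₂ (here refl)
  ... | inj₁ L≺A with notAbove⇒allBelow⊎∈ A C (λ L∈C → notAbove (there L∈C))
  ...   | inj₁ C≺A = inj₁ (L≺A ∷ C≺A)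
  ...   | inj₂ A∈C = inj₂ (there A∈C)

  maximal∧¬strictlyMaximal⇒duplicate : ∀ {A C} → Maximal (pos A) C →
    ¬ StrictlyMaximal (pos A) C → Σ Clause λ C' → C ↭ C' ++ pos A ∷ pos A ∷ []
  maximal∧¬strictlyMaximal⇒duplicate {A} {C} (A∈C , A-max) ¬A-smax
    with C' , C↭AC' ← ∈⇒↭∷ A∈C
    with notAbove⇒allBelow⊎∈ A C' (λ L∈C' → A-max (∈-resp-↭ (↭-sym C↭AC') (there L∈C')))
  ... | inj₁ C'≺A = ⊥-elim (¬A-smax (C' , C↭AC' , C'≺A))
  ... | inj₂ A∈C' with C'' , C'↭AC'' ← ∈⇒↭∷ A∈C' =
    C'' , ↭-trans C↭AC' (↭-trans (prep (pos A) C'↭AC'') (++-comm (pos A ∷ pos A ∷ []) C''))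

  neg∈⇒¬strictlyMaximal-pos : ∀ {A C} → neg A ∈ C → ¬ StrictlyMaximal (pos A) C
  neg∈⇒¬strictlyMaximal-pos ¬A∈C (C' , C↭AC' , C'≺A) with ∈-resp-↭ C↭AC' ¬A∈C
  ... | there ¬A∈C' with atom< A<A ← lookup C'≺A ¬A∈C' = irrefl refl A<A

  ⊨-∪I : ∀ {I J : Interp} C → (∀ {B} → neg B ∈ C → ¬ J B) → I ⊨ C → (I ∪I J) ⊨ C
  ⊨-∪I (pos B ∷ C) _ (here B∈I) = here (inj₁ B∈I)
  ⊨-∪I (neg B ∷ C) ¬J (here B∉I) = here λ { (inj₁ B∈I) → B∉I B∈I
                                          ; (inj₂ B∈J) → ¬J (here refl) B∈J }
  ⊨-∪I (_ ∷ C) ¬J (there I⊨C) = there (⊨-∪I C (λ ¬B∈C → ¬J (there ¬B∈C)) I⊨C)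

  module ModelFacts (N : ClauseSet) (δ : Clause → Atom → Set) where
    open Model N δ

    module _ (model : IsModelOperator) where

      produces⇒strictlyMaximal : ∀ {D B} → δ D B → StrictlyMaximal (pos B) D
      produces⇒strictlyMaximal {D} {B} δDB =
        proj₁ (proj₂ (Equivalence.to (model D B) δDB))

      false⇒¬strictlyMaximal-pos : ∀ {A C} → N C → ¬ (NC C ∪I δI C) ⊨ C →
                                   pos A ∈ C → ¬ StrictlyMaximal (pos A) C
      false⇒¬strictlyMaximal-pos {A} {C} C∈N C-false A∈C A-smax =
        C-false (lose A∈C (inj₂ C-produces-A))
        where
        C-produces-A : δ C A
        C-produces-A = Equivalence.from (model C A)
          (C∈N , A-smax , λ NC⊨C → C-false (⊨-∪I C
            (λ ¬B∈C δCB → neg∈⇒¬strictlyMaximal-pos ¬B∈C (produces⇒strictlyMaximal δCB))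
            NC⊨C))

      false⇒producer : ExcludedMiddle 0ℓ → ∀ {A C} → ¬ (NC C ∪I δI C) ⊨ C →
                       neg A ∈ C → Σ Clause λ D → N D × (D ≺C C) × δ D A
      false⇒producer em {A} {C} C-false ¬A∈C with em {(NC C ∪I δI C) A}
      ... | no A∉I = ⊥-elim (C-false (lose ¬A∈C A∉I))
      ... | yes (inj₁ A∈NC) = A∈NC
      ... | yes (inj₂ δCA) =
        ⊥-elim (neg∈⇒¬strictlyMaximal-pos ¬A∈C (produces⇒strictlyMaximal δCA))

      false-neg⇒supLeftApplicable :
        ExcludedMiddle 0ℓ → ∀ {A C} → N C → ¬ (NC C ∪I δI C) ⊨ C → Maximal (neg A) C →
        Σ Clause λ D → N D × (D ≺C C) × StrictlyMaximal (pos A) D × δ D A ×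
          SupLeftApplicable N D C A
      false-neg⇒supLeftApplicable em {A} C∈N C-false ¬A-max@(¬A∈C , _)
        with D , D∈N , D≺C , δDA ← false⇒producer em C-false ¬A∈C
        with D-smax@(D' , D↭AD' , _) ← produces⇒strictlyMaximal δDA
        with C' , C↭¬AC' ← ∈⇒↭∷ ¬A∈C =
        D , D∈N , D≺C , D-smax , δDA , D∈N , C∈N ,
        (D' , C' , ↭-trans D↭AD' (∷↭∷ʳ (pos A) D') , ↭-trans C↭¬AC' (∷↭∷ʳ (neg A) C')) ,
        D-smax , ¬A-max

      false-pos⇒factoringApplicable :
        ∀ {A C} → N C → ¬ (NC C ∪I δI C) ⊨ C → Maximal (pos A) C →
        ¬ StrictlyMaximal (pos A) C × FactoringApplicable N C A
      false-pos⇒factoringApplicable {A} {C} C∈N C-false A-max@(A∈C , _) =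
        ¬A-smax , C∈N , maximal∧¬strictlyMaximal⇒duplicate A-max ¬A-smax , A-max
        where
        ¬A-smax : ¬ StrictlyMaximal (pos A) C
        ¬A-smax = false⇒¬strictlyMaximal-pos C∈N C-false A∈C

lemma1 : ExcludedMiddle 0ℓ →
    (Atom : Set) (_<_ : Atom → Atom → Set) →
    IsStrictTotalOrder _≡_ _<_ → WellFounded _<_ →
    let open Ground Atom _<_ in
    (N : ClauseSet) (δ : Clause → Atom → Set) →
    let open Model N δ in
    IsModelOperator →
    (C : Clause) → MinimalFalse C → C ≢ [] →
    (L : Lit) → Maximal L C →
    (∀ A → L ≡ neg A →
    Σ Clause λ D → N D × (D ≺C C) × StrictlyMaximal (pos A) D × δ D A ×
    SupLeftApplicable N D C A)
    ×
    (∀ A → L ≡ pos A →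
    ¬ StrictlyMaximal (pos A) C × FactoringApplicable N C A)
lemma1 em Atom _<_ <-sto _ N δ model C (C∈N , C-false , _) _ L L-max =
  (λ { A refl → false-neg⇒supLeftApplicable model em C∈N C-false L-max }) ,
  (λ { A refl → false-pos⇒factoringApplicable model C∈N C-false L-max })
  where
  open GroundFacts Atom _<_ <-sto
  open ModelFacts N δ
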